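{- Let $k \ge 2$. There is a coloring $c: V(L_{k+3}) \to [k+3]$ of the 2-ribbon $L_{k+3}$ that realizes every pair of colors $\{i,j\}$ with $i \in [k]$ and $j \in \{k+1,k+2,k+3\}$, as well as the pairs $\{k+1,k+2\}$, $\{k+1,k+3\}$ and $\{k+2,k+3\}$.
   Context: For $n \ge 1$, the 2-ribbon of length $n$, $L_n$, is the rectangular grid graph of dimensions $(2 \times n)$: vertices $(i,j) \in \mathbb{Z}^2$ with $1 \le i \le 2$, $1 \le j \le n$, and $(i_1,j_1) \sim (i_2,j_2)$ iff $|i_1-i_2|+|j_1-j_2|=1$. A coloring $c$ realizes the pair of colors $\{a,b\}$ if there is an edge $\{v,w\}$ with $c(v)=a$ and $c(w)=b$. $[k]=\{1,\dots,k\}$. -}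

module Defs where

open import Data.Nat using (ℕ; suc; _+_; _≤_)
open import Data.Fin using (Fin; toℕ)
open import Data.Product using (_×_; _,_; ∃-syntax)
open import Data.Sum using (_⊎_)
open import Relation.Binary.PropositionalEquality using (_≡_)

-- Vertices of the 2-ribbon L_n: pairs (i , j), i ∈ Fin 2 (row), j ∈ Fin n (column).
-- (0-based indices stand for the paper's 1-based coordinates.)
Vertex : ℕ → Set
Vertex n = Fin 2 × Fin n

Dist1 : ℕ → ℕ → Set
Dist1 a b = suc a ≡ b ⊎ suc b ≡ a

Adj : (n : ℕ) → Vertex n → Vertex n → Set
Adj n (i₁ , j₁) (i₂ , j₂) =
  (i₁ ≡ i₂ × Dist1 (toℕ j₁) (toℕ j₂)) ⊎ (j₁ ≡ j₂ × Dist1 (toℕ i₁) (toℕ i₂))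

Coloring : ℕ → ℕ → Set
Coloring n m = Vertex n → ℕ

IsColoring : (n m : ℕ) → Coloring n m → Set
IsColoring n m c = (v : Vertex n) → 1 ≤ c v × c v ≤ m

Realizes : (n m : ℕ) → Coloring n m → ℕ → ℕ → Set
Realizes n m c a b = ∃[ v ] ∃[ w ] (Adj n v w × c v ≡ a × c w ≡ b)

module Submission where

-- Colour column j of L_{k+3} (columns 0,…,k+2) by putting a "label" in
-- row par j (the parity of j) and a "big" colour k+1+(j mod 3) ∈ {k+1,k+2,k+3}
-- in the other row; the label of column j ≥ 1 is j itself, that of column 0 is k+3.
-- Since rows alternate, the cell carrying label i (1 ≤ i ≤ k+1) is adjacent to
-- the big cells of columns i-1 (left), i (below/above) and i+1 (right), whose big
-- colours are k+1+(i-1 mod 3), k+1+(i mod 3), k+1+(i+1 mod 3): all three big colours.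
-- This gives every pair {i , j} with i ≤ k+1 < j, in particular {k+1,k+2} and
-- {k+1,k+3}; the remaining pair {k+2,k+3} sits at columns 0 and 1 of row 0.
-- The construction works for every k.

open import Defs
open import Data.Nat using (ℕ; zero; suc; _+_; _∸_; _≤_; _<_; z≤n; s≤s)
open import Data.Nat.Properties
  using (≤-refl; ≤-trans; m≤m+n; m≤n+m; +-assoc; +-comm; +-monoˡ-≤; +-monoʳ-≤; +-cancelˡ-≤; m+[n∸m]≡n; <⇒≤)
open import Data.Fin using (Fin; toℕ; fromℕ<) renaming (zero to fz; suc to fs)
open import Data.Fin.Properties using (toℕ-fromℕ<; toℕ<n; toℕ≤pred[n])
open import Data.Product using (_×_; _,_; ∃-syntax)
open import Data.Sum using (_⊎_; inj₁; inj₂)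
open import Relation.Binary.PropositionalEquality using (_≡_; refl; sym; trans; cong; subst; subst₂)

onGrid : ∀ {n m} → (Fin 2 → ℕ → ℕ) → Coloring n m
onGrid f (r , j) = f r (toℕ j)

adj-sym : ∀ {n} (v w : Vertex n) → Adj n v w → Adj n w v
adj-sym _ _ (inj₁ (e , inj₁ d)) = inj₁ (sym e , inj₂ d)
adj-sym _ _ (inj₁ (e , inj₂ d)) = inj₁ (sym e , inj₁ d)
adj-sym _ _ (inj₂ (e , inj₁ d)) = inj₂ (sym e , inj₂ d)
adj-sym _ _ (inj₂ (e , inj₂ d)) = inj₂ (sym e , inj₁ d)

realizes-sym : ∀ {n m c a b} → Realizes n m c a b → Realizes n m c b a
realizes-sym (v , w , adj , ca , cb) = w , v , adj-sym v w adj , cb , ca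

flip : Fin 2 → Fin 2
flip fz = fs fz
flip (fs _) = fz

flip-dist : ∀ r → Dist1 (toℕ r) (toℕ (flip r))
flip-dist fz = inj₁ refl
flip-dist (fs fz) = inj₂ refl

horizontal-edge : ∀ {n m} (f : Fin 2 → ℕ → ℕ) r j (sj<n : suc j < n) →
  Realizes n m (onGrid {n} {m} f) (f r j) (f r (suc j))
horizontal-edge f r j sj<n =
  (r , fromℕ< j<n) , (r , fromℕ< sj<n) ,
  inj₁ (refl , inj₁ (trans (cong suc (toℕ-fromℕ< j<n)) (sym (toℕ-fromℕ< sj<n)))) ,
  cong (f r) (toℕ-fromℕ< j<n) , cong (f r) (toℕ-fromℕ< sj<n)
  where
  j<n = <⇒≤ sj<n

vertical-edge : ∀ {n m} (f : Fin 2 → ℕ → ℕ) r j (j<n : j < n) →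
  Realizes n m (onGrid {n} {m} f) (f r j) (f (flip r) j)
vertical-edge f r j j<n =
  (r , fromℕ< j<n) , (flip r , fromℕ< j<n) , inj₂ (refl , flip-dist r) ,
  cong (f r) (toℕ-fromℕ< j<n) , cong (f (flip r)) (toℕ-fromℕ< j<n)

put : Fin 2 → ℕ → ℕ → Fin 2 → ℕ
put fz     a b fz     = a
put fz     a b (fs _) = b
put (fs _) a b fz     = b
put (fs _) a b (fs _) = a

put-here : ∀ p {a b} → put p a b p ≡ a
put-here fz = refl
put-here (fs fz) = refl

put-other : ∀ p {a b} → put p a b (flip p) ≡ b
put-other fz = refl
put-other (fs fz) = refl

put-back : ∀ p {a b} → put (flip p) a b p ≡ b
put-back fz = refl
put-back (fs fz) = refl

put-preserves : ∀ (P : ℕ → Set) p {a b} r → P a → P b → P (put p a b r)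
put-preserves P fz fz pa pb = pa
put-preserves P fz (fs _) pa pb = pb
put-preserves P (fs _) fz pa pb = pb
put-preserves P (fs _) (fs _) pa pb = pa

par : ℕ → Fin 2
par zero = fz
par (suc j) = flip (par j)

rot : Fin 3 → Fin 3
rot fz = fs fz
rot (fs fz) = fs (fs fz)
rot (fs (fs _)) = fz

tri : ℕ → Fin 3
tri zero = fz
tri (suc j) = rot (tri j)

rot-window : ∀ x t → x ≡ t ⊎ rot x ≡ t ⊎ rot (rot x) ≡ t
rot-window fz fz = inj₁ refl
rot-window fz (fs fz) = inj₂ (inj₁ refl)
rot-window fz (fs (fs fz)) = inj₂ (inj₂ refl)
rot-window (fs fz) fz = inj₂ (inj₂ refl)
rot-window (fs fz) (fs fz) = inj₁ refl
rot-window (fs fz) (fs (fs fz)) = inj₂ (inj₁ refl)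
rot-window (fs (fs fz)) fz = inj₂ (inj₁ refl)
rot-window (fs (fs fz)) (fs fz) = inj₂ (inj₂ refl)
rot-window (fs (fs fz)) (fs (fs fz)) = inj₁ refl

tri-window : ∀ j t → tri j ≡ t ⊎ tri (suc j) ≡ t ⊎ tri (suc (suc j)) ≡ t
tri-window j t = rot-window (tri j) t

offset : ∀ {a d j} → a ≤ j → j ≤ a + d → ∃[ t ] a + toℕ {suc d} t ≡ j
offset {a} {d} {j} a≤j j≤a+d = fromℕ< (s≤s o≤d) , trans (cong (a +_) (toℕ-fromℕ< (s≤s o≤d))) a+o≡j
  where
  a+o≡j : a + (j ∸ a) ≡ j
  a+o≡j = m+[n∸m]≡n a≤j
  o≤d : j ∸ a ≤ d
  o≤d = +-cancelˡ-≤ a _ d (subst (_≤ a + d) (sym a+o≡j) j≤a+d)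

big : ℕ → Fin 3 → ℕ
big k t = k + 1 + toℕ t

label : ℕ → ℕ → ℕ
label k zero = k + 3
label k (suc j) = suc j

ribbon : ℕ → Fin 2 → ℕ → ℕ
ribbon k r j = put (par j) (label k j) (big k (tri j)) r

colouring : (k : ℕ) → Coloring (k + 3) (k + 3)
colouring k = onGrid {k + 3} {k + 3} (ribbon k)

Meets : ℕ → ℕ → ℕ → Set
Meets k = Realizes (k + 3) (k + 3) (colouring k)

big-range : ∀ k t → 1 ≤ big k t × big k t ≤ k + 3
big-range k t =
  ≤-trans (m≤n+m 1 k) (m≤m+n (k + 1) (toℕ t)) ,
  subst (k + 1 + toℕ t ≤_) (+-assoc k 1 2) (+-monoʳ-≤ (k + 1) (toℕ≤pred[n] t))

label-range : ∀ k j → j < k + 3 → 1 ≤ label k j × label k j ≤ k + 3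
label-range k zero _ = subst (1 ≤_) (+-comm 3 k) (s≤s z≤n) , ≤-refl
label-range k (suc j) j<n = s≤s z≤n , <⇒≤ j<n

ribbon-range : ∀ k r j → j < k + 3 → 1 ≤ ribbon k r j × ribbon k r j ≤ k + 3
ribbon-range k r j j<n =
  put-preserves (λ x → 1 ≤ x × x ≤ k + 3) (par j) r (label-range k j j<n) (big-range k (tri j))

-- The cell carrying label i is (par i , i); its neighbours in the other row and in
-- the neighbouring columns (same row, hence opposite parity) carry big colours.
on-label : ∀ k j → ribbon k (par j) j ≡ label k j
on-label k j = put-here (par j)

below-label : ∀ k j → ribbon k (flip (par j)) j ≡ big k (tri j)
below-label k j = put-other (par j)

right-of-label : ∀ k j → ribbon k (par j) (suc j) ≡ big k (tri (suc j))
right-of-label k j = put-back (par j)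

next-column : ∀ {i k} → i ≤ k + 1 → suc (suc i) ≤ k + 3
next-column {i} {k} le = subst₂ _≤_ (+-comm i 2) (+-assoc k 1 2) (+-monoˡ-≤ 2 le)

-- Key lemma: each label i ∈ [1 , k+1] is adjacent to every big colour, found in
-- column i-1, i or i+1 according to which of three consecutive residues it is.
meets-big : ∀ k i → 1 ≤ i → i ≤ k + 1 → (t : Fin 3) → Meets k i (big k t)
meets-big k (suc j) _ i≤k+1 t with tri-window j t
... | inj₁ refl =
  realizes-sym {m = k + 3} (subst₂ (Meets k) (below-label k j) (on-label k (suc j))
    (horizontal-edge {m = k + 3} (ribbon k) (par (suc j)) j (<⇒≤ (next-column i≤k+1))))
... | inj₂ (inj₁ refl) =
  subst₂ (Meets k) (on-label k (suc j)) (below-label k (suc j))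
    (vertical-edge {m = k + 3} (ribbon k) (par (suc j)) (suc j) (<⇒≤ (next-column i≤k+1)))
... | inj₂ (inj₂ refl) =
  subst₂ (Meets k) (on-label k (suc j)) (right-of-label k (suc j))
    (horizontal-edge {m = k + 3} (ribbon k) (par (suc j)) (suc j) (next-column i≤k+1))

meets-top : ∀ k i → 1 ≤ i → i ≤ k + 1 → (j : ℕ) → k + 1 ≤ j → j ≤ k + 3 → Meets k i j
meets-top k i 1≤i i≤k+1 j lo hi with offset {d = 2} lo (subst (j ≤_) (sym (+-assoc k 1 2)) hi)
... | t , refl = meets-big k i 1≤i i≤k+1 t

lemma5 : (k : ℕ) → 2 ≤ k →
    ∃[ c ] (IsColoring (k + 3) (k + 3) c
    × ((i : ℕ) → 1 ≤ i → i ≤ k → (j : ℕ) → k + 1 ≤ j → j ≤ k + 3 → Realizes (k + 3) (k + 3) c i j)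
    × Realizes (k + 3) (k + 3) c (k + 1) (k + 2)
    × Realizes (k + 3) (k + 3) c (k + 1) (k + 3)
    × Realizes (k + 3) (k + 3) c (k + 2) (k + 3))
lemma5 k _ =
  colouring k ,
  (λ { (r , j) → ribbon-range k r (toℕ j) (toℕ<n j) }) ,
  (λ i 1≤i i≤k → meets-top k i 1≤i (≤-trans i≤k k≤k+1)) ,
  meets-top k (k + 1) 1≤k+1 ≤-refl (k + 2) k+1≤k+2 (+-monoʳ-≤ k (s≤s (s≤s z≤n))) ,
  meets-top k (k + 1) 1≤k+1 ≤-refl (k + 3) (+-monoʳ-≤ k (s≤s z≤n)) ≤-refl ,
  -- {k+2 , k+3}: row 0 carries k+3 in column 0 (its label) and k+2 in column 1.
  realizes-sym {m = k + 3} (subst (Meets k (k + 3)) (+-assoc k 1 1)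
    (horizontal-edge {m = k + 3} (ribbon k) fz 0 (≤-trans (s≤s (s≤s z≤n)) (m≤n+m 3 k))))
  where
  k≤k+1 : k ≤ k + 1
  k≤k+1 = m≤m+n k 1
  1≤k+1 : 1 ≤ k + 1
  1≤k+1 = m≤n+m 1 k
  k+1≤k+2 : k + 1 ≤ k + 2
  k+1≤k+2 = +-monoʳ-≤ k (s≤s z≤n)
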